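{- For $s,t\ge 2$, $\mathrm{edim}_f(P_s\,\square\, P_t)=2$, where $P_s\,\square\,P_t$ is the Cartesian product of the paths $P_s$ and $P_t$.
   Context: All graphs are finite, simple, undirected; $d(u,w)$ is the length of a shortest $u$–$w$ path. For a vertex $v$ and an edge $e=xy$, $d(e,v)=\min\{d(x,v),d(y,v)\}$; for distinct edges $e_1,e_2$, $R_e\{e_1,e_2\}=\{v: d(v,e_1)\neq d(v,e_2)\}$. For $g:V\to\mathbb{R}$ and $U\subseteq V$, $g(U)=\sum_{s\in U}g(s)$. A function $g:V(G)\to[0,1]$ is an edge resolving function of $G$ if $g(R_e\{e_1,e_2\})\ge1$ for all distinct edges $e_1,e_2$, and $\mathrm{edim}_f(G)=\min\{g(V(G)): g\text{ an edge resolving function of }G\}$.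
   Formalization: The functions g in the definition of $\mathrm{edim}_f$ take rational values in [0,1] instead of real ones. -}

module Defs where

open import Data.Bool using (Bool; true; false; _∧_; _∨_; if_then_else_)
open import Data.Nat as ℕ using (ℕ; zero; suc; _⊓_; _∸_)
open import Data.Fin using (Fin; toℕ)
open import Data.Fin.Properties using () renaming (_≟_ to _≟ᶠ_)
open import Data.Bool.ListAction using (any)
open import Data.List using (List; length; foldr; filter; cartesianProduct; allFin)
open import Data.Product using (_×_; _,_; Σ-syntax; proj₁; proj₂)
open import Data.Sum using (_⊎_)
open import Relation.Binary.PropositionalEquality using (_≡_)
open import Relation.Binary.Definitions using (DecidableEquality)
open import Relation.Nullary using (¬_; does)
open import Relation.Nullary.Decidable using (¬?)
open import Data.Rational as ℚ using (ℚ; 0ℚ; 1ℚ)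

record Graph : Set₁ where
  field
    V     : Set
    _≟V_  : DecidableEquality V
    verts : List V
    adj   : V → V → Bool

open Graph public

absDiff : ℕ → ℕ → ℕ
absDiff m n = (m ∸ n) ℕ.+ (n ∸ m)

Path : ℕ → Graph
Path n = record
  { V = Fin n ; _≟V_ = _≟ᶠ_ ; verts = allFin n
  ; adj = λ i j → does (absDiff (toℕ i) (toℕ j) ℕ.≟ 1) }

eqB : (G : Graph) → V G → V G → Bool
eqB G x y = does (_≟V_ G x y)

_□_ : Graph → Graph → Graph
G □ H = record
  { V = V G × V H
  ; _≟V_ = λ { (a , b) (c , d) → dec a b c d }
  ; verts = cartesianProduct (verts G) (verts H)
  ; adj = λ { (a , b) (c , d) → (eqB G a c ∧ adj H b d) ∨ (adj G a c ∧ eqB H b d) } }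
  where
  open import Data.Product.Properties using (≡-dec)
  dec : (a : V G) (b : V H) (c : V G) (d : V H) → _
  dec a b c d = ≡-dec (_≟V_ G) (_≟V_ H) (a , b) (c , d)

reach : (G : Graph) → ℕ → V G → V G → Bool
reach G zero    u v = eqB G u v
reach G (suc k) u v = reach G k u v ∨ any (λ w → reach G k u w ∧ adj G w v) (verts G)

-- Shortest-path distance: least k with a walk of length ≤ k
-- (searching k = 0..|V|-1; unreachable pairs get value |V|, irrelevant for connected graphs).
dist : (G : Graph) → V G → V G → ℕ
dist G u v = search 0 (length (verts G))
  where
  search : ℕ → ℕ → ℕ
  search k zero       = k
  search k (suc fuel) = if reach G k u v then k else search (suc k) fuel

-- An edge is given by its endpoints (x , y) with adj x y ≡ true.
-- d(e , v) = min { d(x , v) , d(y , v) }.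
edgeDist : (G : Graph) → V G × V G → V G → ℕ
edgeDist G (x , y) v = dist G x v ⊓ dist G y v

DistinctEdges : (G : Graph) → V G × V G → V G × V G → Set
DistinctEdges G (x , y) (x' , y') = ¬ ((x ≡ x' × y ≡ y') ⊎ (x ≡ y' × y ≡ x'))

IsEdge : (G : Graph) → V G × V G → Set
IsEdge G (x , y) = adj G x y ≡ true

-- g(U) for U given as the sublist of the vertex enumeration satisfying a predicate.
sumℚ : {A : Set} → (A → ℚ) → List A → ℚ
sumℚ g xs = foldr (λ a r → g a ℚ.+ r) 0ℚ xs

weightR : (G : Graph) → (V G → ℚ) → V G × V G → V G × V G → ℚ
weightR G g e₁ e₂ =
  sumℚ g (filter (λ v → ¬? (edgeDist G e₁ v ℕ.≟ edgeDist G e₂ v)) (verts G))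

IsEdgeResolving : (G : Graph) → (V G → ℚ) → Set
IsEdgeResolving G g =
  ((v : V G) → (0ℚ ℚ.≤ g v) × (g v ℚ.≤ 1ℚ)) ×
  ((e₁ e₂ : V G × V G) → IsEdge G e₁ → IsEdge G e₂ → DistinctEdges G e₁ e₂ →
     1ℚ ℚ.≤ weightR G g e₁ e₂)

EdimF≡ : Graph → ℚ → Set
EdimF≡ G r =
  (Σ[ g ∈ (V G → ℚ) ] (IsEdgeResolving G g × sumℚ g (verts G) ≡ r)) ×
  ((g : V G → ℚ) → IsEdgeResolving G g → r ℚ.≤ sumℚ g (verts G))

{-# OPTIONS --safe #-}
module Submission where

-- In P_s □ P_t the distance is the ℓ¹ distance, and the two ends x, y of an
-- edge are at distances from any vertex v that differ by exactly one, so
-- 2 d(xy, v) + 1 = d(x, v) + d(y, v).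
--
-- Lower bound: for the edges e₀ = (0,0)(1,0), e₁ = (0,0)(0,1), e₂ = (1,0)(1,1)
-- of a corner square every vertex v has d(v,e₀) = d(v,e₁) or d(v,e₀) = d(v,e₂).
-- Hence R{e₀,e₁} and R{e₀,e₂} are disjoint, and every edge resolving function
-- has weight at least 1 + 1.
--
-- Upper bound: for the corners A = (0,0) and L = (s-1,0) the endpoint sums
-- d(x,A) + d(y,A) and d(x,L) + d(y,L) are X + Y and 2(s-1) - X + Y, where
-- (X , Y) is twice the midpoint of the edge xy. The midpoint determines the
-- edge, so {A, L} resolves all edges and its indicator function has weight 2.

open import Defs
open import Data.Nat using (ℕ; suc; _≥_)

module Sums where
  open import Algebra.Bundles using (CommutativeMonoid)
  open import Data.Bool using (if_then_else_)
  open import Data.Empty using (⊥-elim)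
  open import Data.List using ([]; _∷_; filter)
  open import Data.List.Membership.Propositional using (_∈_; _∉_)
  open import Data.List.Relation.Unary.All.Properties using (All¬⇒¬Any)
  open import Data.List.Relation.Unary.Any using (here; there)
  open import Data.List.Relation.Unary.Unique.Propositional using (Unique; _∷_)
  open import Data.Rational using (ℚ; 0ℚ; 1ℚ; _+_; _≤_)
  open import Data.Rational.Properties
    using (≤-refl; ≤-trans; ≤-reflexive; +-assoc; +-identityˡ; +-identityʳ; +-mono-≤; +-monoʳ-≤;
           +-0-commutativeMonoid; module ≤-Reasoning)
  open import Function using (_∘_)
  open import Relation.Binary.Definitions using (DecidableEquality)
  open import Relation.Binary.PropositionalEquality using (_≡_; refl; sym; trans; cong)
  open import Relation.Nullary using (¬_; yes; no; does)
  open import Relation.Unary using (Decidable)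
  open import Algebra.Properties.CommutativeSemigroup
    (CommutativeMonoid.commutativeSemigroup +-0-commutativeMonoid) using (interchange; x∙yz≈y∙xz)

  module _ {A : Set} {g : A → ℚ} (g≥0 : ∀ x → 0ℚ ≤ g x) where

    sumℚ-nonneg : ∀ xs → 0ℚ ≤ sumℚ g xs
    sumℚ-nonneg []       = ≤-refl
    sumℚ-nonneg (x ∷ xs) = +-mono-≤ (g≥0 x) (sumℚ-nonneg xs)

    ∈⇒≤sumℚ : ∀ {x xs} → x ∈ xs → g x ≤ sumℚ g xs
    ∈⇒≤sumℚ {x} {_ ∷ xs} (here refl) = begin
      g x               ≡⟨ +-identityʳ (g x) ⟨
      g x + 0ℚ          ≤⟨ +-monoʳ-≤ (g x) (sumℚ-nonneg xs) ⟩
      g x + sumℚ g xs   ∎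
      where open ≤-Reasoning
    ∈⇒≤sumℚ {x} {y ∷ xs} (there x∈xs) = begin
      g x               ≡⟨ +-identityˡ (g x) ⟨
      0ℚ + g x          ≤⟨ +-mono-≤ (g≥0 y) (∈⇒≤sumℚ x∈xs) ⟩
      g y + sumℚ g xs   ∎
      where open ≤-Reasoning

    module _ {P Q : A → Set} (P? : Decidable P) (Q? : Decidable Q) (disjoint : ∀ x → P x → ¬ Q x) where

      sumℚ-disjoint-filters : ∀ xs → sumℚ g (filter P? xs) + sumℚ g (filter Q? xs) ≤ sumℚ g xs
      sumℚ-disjoint-filters []       = ≤-refl
      sumℚ-disjoint-filters (x ∷ xs) with P? x | Q? x
      ... | yes p | yes q = ⊥-elim (disjoint x p q)
      ... | yes _ | no _  = ≤-trans (≤-reflexive (+-assoc (g x) F H)) (+-monoʳ-≤ (g x) (sumℚ-disjoint-filters xs))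
        where F = sumℚ g (filter P? xs); H = sumℚ g (filter Q? xs)
      ... | no _  | yes _ = ≤-trans (≤-reflexive (x∙yz≈y∙xz F (g x) H)) (+-monoʳ-≤ (g x) (sumℚ-disjoint-filters xs))
        where F = sumℚ g (filter P? xs); H = sumℚ g (filter Q? xs)
      ... | no _  | no _  = ≤-trans (≤-reflexive (sym (+-identityˡ (F + H)))) (+-mono-≤ (g≥0 x) (sumℚ-disjoint-filters xs))
        where F = sumℚ g (filter P? xs); H = sumℚ g (filter Q? xs)

  sumℚ-+ : ∀ {A : Set} (f h : A → ℚ) xs → sumℚ (λ x → f x + h x) xs ≡ sumℚ f xs + sumℚ h xs
  sumℚ-+ f h []       = refl
  sumℚ-+ f h (x ∷ xs) = trans (cong (f x + h x +_) (sumℚ-+ f h xs)) (interchange (f x) (h x) _ _)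

  pointMass : {A : Set} → DecidableEquality A → A → A → ℚ
  pointMass _≟_ a x = if does (x ≟ a) then 1ℚ else 0ℚ

  module _ {A : Set} (_≟_ : DecidableEquality A) (a : A) where

    sumℚ-pointMass-∉ : ∀ {xs} → a ∉ xs → sumℚ (pointMass _≟_ a) xs ≡ 0ℚ
    sumℚ-pointMass-∉ {[]}     a∉xs = refl
    sumℚ-pointMass-∉ {x ∷ xs} a∉xs with x ≟ a
    ... | yes refl = ⊥-elim (a∉xs (here refl))
    ... | no _     = trans (+-identityˡ _) (sumℚ-pointMass-∉ (a∉xs ∘ there))

    sumℚ-pointMass : ∀ {xs} → Unique xs → a ∈ xs → sumℚ (pointMass _≟_ a) xs ≡ 1ℚ
    sumℚ-pointMass {x ∷ xs} (x∉xs ∷ _) (here refl) with x ≟ x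
    ... | yes _   = trans (cong (1ℚ +_) (sumℚ-pointMass-∉ (All¬⇒¬Any x∉xs))) (+-identityʳ 1ℚ)
    ... | no x≢x  = ⊥-elim (x≢x refl)
    sumℚ-pointMass {x ∷ xs} (x∉xs ∷ unique) (there a∈xs) with x ≟ a
    ... | yes refl = ⊥-elim (All¬⇒¬Any x∉xs a∈xs)
    ... | no _     = trans (+-identityˡ _) (sumℚ-pointMass unique a∈xs)

module Graphs where
  open import Data.Bool using (true; false; T)
  open import Data.Bool.Properties using (T-∨; T-∧)
  open import Data.List using (List; []; _∷_; length; map; _++_; cartesianProduct)
  open import Data.List.Properties using (length-++; length-map)
  open import Data.Nat using (zero; _+_; _*_; _≤_; _<_; z≤n)
  open import Data.Nat.Properties using (+-identityʳ; +-suc; ≤-antisym; ≤∧≢⇒<; ≤⇒≯)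
  open import Data.Product using (_×_; _,_)
  open import Data.Product.Function.NonDependent.Propositional using (_×-⇔_)
  open import Data.Sum using (_⊎_)
  open import Data.Sum.Function.Propositional using (_⊎-⇔_)
  open import Data.Unit using (tt)
  open import Function using (const)
  open import Function.Bundles using (_⇔_; mk⇔)
  open import Function.Construct.Composition using (_⇔-∘_)
  open import Function.Construct.Identity using (⇔-id)
  open import Relation.Binary.PropositionalEquality
  open import Relation.Nullary using (Dec; yes; no; does; contradiction)

  -- `dist` runs a search loop local to its where-block; abstracting over the
  -- loop's two arguments lets unification give that loop a name.
  mutual
    distLoop : (G : Graph) → V G → V G → ℕ → ℕ → ℕ
    distLoop = _

    dist≡distLoop : ∀ G u v → dist G u v ≡ distLoop G u v 0 (length (verts G))
    dist≡distLoop G u v with length (verts G)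
    ... | n with 0
    ... | k = refl

  module _ (G : Graph) (u v : V G) {m : ℕ}
           (minimal : ∀ j → T (reach G j u v) → m ≤ j) (reached : T (reach G m u v)) where

    distLoop-least : ∀ fuel k → k ≤ m → m < k + fuel → distLoop G u v k fuel ≡ m
    distLoop-least zero       k k≤m m<k+0 =
      contradiction (subst (m <_) (+-identityʳ k) m<k+0) (≤⇒≯ k≤m)
    distLoop-least (suc fuel) k k≤m m<k+1+fuel with reach G k u v in eq
    ... | true  = ≤-antisym k≤m (minimal k (subst T (sym eq) tt))
    ... | false = distLoop-least fuel (suc k) (≤∧≢⇒< k≤m k≢m) (subst (m <_) (+-suc k fuel) m<k+1+fuel)
      where
      k≢m : k ≢ m
      k≢m refl = subst T eq reached

    dist-least : m < length (verts G) → dist G u v ≡ m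
    dist-least m<|V| = trans (dist≡distLoop G u v) (distLoop-least _ 0 z≤n m<|V|)

  length-cartesianProduct : ∀ {A B : Set} (xs : List A) (ys : List B) →
    length (cartesianProduct xs ys) ≡ length xs * length ys
  length-cartesianProduct []       ys = refl
  length-cartesianProduct (x ∷ xs) ys = begin
    length (map (x ,_) ys ++ cartesianProduct xs ys)          ≡⟨ length-++ (map (x ,_) ys) ⟩
    length (map (x ,_) ys) + length (cartesianProduct xs ys)
      ≡⟨ cong₂ _+_ (length-map (x ,_) ys) (length-cartesianProduct xs ys) ⟩
    length ys + length xs * length ys                         ∎
    where open ≡-Reasoning

  T-does : ∀ {A : Set} (a? : Dec A) → T (does a?) ⇔ A
  T-does (yes a) = mk⇔ (const a) (const tt)
  T-does (no ¬a) = mk⇔ (λ ()) ¬a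

  eqB⇔≡ : ∀ G {x y : V G} → T (eqB G x y) ⇔ x ≡ y
  eqB⇔≡ G {x} {y} = T-does (_≟V_ G x y)

  □-adj : ∀ {G H} {a c : V G} {b d : V H} →
    T (adj (G □ H) (a , b) (c , d)) ⇔ ((a ≡ c × T (adj H b d)) ⊎ (T (adj G a c) × b ≡ d))
  □-adj {G} {H} = (eqB⇔≡ G ×-⇔ ⇔-id _ ⊎-⇔ ⇔-id _ ×-⇔ eqB⇔≡ H) ⇔-∘ ((T-∧ ⊎-⇔ T-∧) ⇔-∘ T-∨)

module EdgeResolving (G : Graph) where
  open Sums
  open import Data.Empty using (⊥-elim)
  open import Data.List.Membership.Propositional using (_∈_)
  open import Data.List.Membership.Propositional.Properties using (∈-filter⁺)
  open import Data.List.Relation.Unary.Unique.Propositional using (Unique)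
  open import Data.Nat using (_≟_)
  open import Data.Product using (_×_; _,_; proj₁; Σ-syntax)
  open import Data.Rational using (ℚ; 0ℚ; 1ℚ; _+_; _≤_)
  open import Data.Rational.Properties using (+-mono-≤; ≤-trans; ≤-refl; ≤-reflexive; nonNegative⁻¹)
  open import Data.Sum using (_⊎_; [_,_])
  open import Function using (_∘_)
  open import Relation.Binary.PropositionalEquality using (_≡_; _≢_; refl; sym; trans; cong₂)
  open import Relation.Nullary using (yes; no)
  open import Relation.Nullary.Decidable using (¬?)

  disjointResolvingSets⇒2≤weight : ∀ {e₀ e₁ e₂} →
    IsEdge G e₀ → IsEdge G e₁ → IsEdge G e₂ → DistinctEdges G e₀ e₁ → DistinctEdges G e₀ e₂ →
    (∀ v → edgeDist G e₀ v ≡ edgeDist G e₁ v ⊎ edgeDist G e₀ v ≡ edgeDist G e₂ v) →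
    ∀ g → IsEdgeResolving G g → 1ℚ + 1ℚ ≤ sumℚ g (verts G)
  disjointResolvingSets⇒2≤weight {e₀} {e₁} {e₂} edge₀ edge₁ edge₂ e₀≠e₁ e₀≠e₂ split g (bounds , resolving) =
    ≤-trans (+-mono-≤ (resolving e₀ e₁ edge₀ edge₁ e₀≠e₁) (resolving e₀ e₂ edge₀ edge₂ e₀≠e₂))
            (sumℚ-disjoint-filters (proj₁ ∘ bounds) _ _ (λ v r₁ r₂ → [ r₁ , r₂ ] (split v)) (verts G))

  module _ {a l : V G} (a≢l : a ≢ l) (unique : Unique (verts G)) (a∈V : a ∈ verts G) (l∈V : l ∈ verts G) where

    twoPointMass : V G → ℚ
    twoPointMass v = pointMass (_≟V_ G) a v + pointMass (_≟V_ G) l v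

    twoPointMass-bounds : ∀ v → 0ℚ ≤ twoPointMass v × twoPointMass v ≤ 1ℚ
    twoPointMass-bounds v with _≟V_ G v a | _≟V_ G v l
    ... | yes refl | yes refl = ⊥-elim (a≢l refl)
    ... | yes _    | no _     = nonNegative⁻¹ 1ℚ , ≤-refl
    ... | no _     | yes _    = nonNegative⁻¹ 1ℚ , ≤-refl
    ... | no _     | no _     = ≤-refl , nonNegative⁻¹ 1ℚ

    twoPointMass-a : twoPointMass a ≡ 1ℚ
    twoPointMass-a with _≟V_ G a a | _≟V_ G a l
    ... | yes _  | no _    = refl
    ... | yes _  | yes a≡l = ⊥-elim (a≢l a≡l)
    ... | no a≢a | _       = ⊥-elim (a≢a refl)

    twoPointMass-l : twoPointMass l ≡ 1ℚ
    twoPointMass-l with _≟V_ G l a | _≟V_ G l l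
    ... | no _    | yes _  = refl
    ... | yes l≡a | _      = ⊥-elim (a≢l (sym l≡a))
    ... | no _    | no l≢l = ⊥-elim (l≢l refl)

    1≤weightR : ∀ {e₁ e₂ v} → v ∈ verts G → twoPointMass v ≡ 1ℚ → edgeDist G e₁ v ≢ edgeDist G e₂ v →
      1ℚ ≤ weightR G twoPointMass e₁ e₂
    1≤weightR {e₁} {e₂} v∈V mass≡1 resolved = ≤-trans (≤-reflexive (sym mass≡1))
      (∈⇒≤sumℚ (proj₁ ∘ twoPointMass-bounds) (∈-filter⁺ (λ v → ¬? (edgeDist G e₁ v ≟ edgeDist G e₂ v)) v∈V resolved))

    resolvingPair⇒weight2 :
      (∀ e₁ e₂ → IsEdge G e₁ → IsEdge G e₂ → DistinctEdges G e₁ e₂ →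
         edgeDist G e₁ a ≢ edgeDist G e₂ a ⊎ edgeDist G e₁ l ≢ edgeDist G e₂ l) →
      Σ[ g ∈ (V G → ℚ) ] (IsEdgeResolving G g × sumℚ g (verts G) ≡ 1ℚ + 1ℚ)
    resolvingPair⇒weight2 resolves =
      twoPointMass ,
      (twoPointMass-bounds ,
       λ e₁ e₂ edge₁ edge₂ e₁≠e₂ →
         [ 1≤weightR a∈V twoPointMass-a , 1≤weightR l∈V twoPointMass-l ] (resolves e₁ e₂ edge₁ edge₂ e₁≠e₂)) ,
      trans (sumℚ-+ (pointMass (_≟V_ G) a) (pointMass (_≟V_ G) l) (verts G))
            (cong₂ _+_ (sumℚ-pointMass (_≟V_ G) a unique a∈V) (sumℚ-pointMass (_≟V_ G) l unique l∈V))

module Arithmetic where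
  open import Data.Nat
  open import Data.Nat.Properties
  open import Data.Product using (_×_; _,_)
  open import Data.Sum using (_⊎_; inj₁; inj₂)
  open import Function using (_∘_)
  open import Relation.Binary.PropositionalEquality
  open import Relation.Nullary using (contradiction)
  open import Algebra.Properties.CommutativeSemigroup +-commutativeSemigroup using (xy∙z≈xz∙y)

  absDiff≡∣-∣ : ∀ m n → absDiff m n ≡ ∣ m - n ∣
  absDiff≡∣-∣ zero    zero    = refl
  absDiff≡∣-∣ zero    (suc n) = refl
  absDiff≡∣-∣ (suc m) zero    = +-identityʳ (suc m)
  absDiff≡∣-∣ (suc m) (suc n) = absDiff≡∣-∣ m n

  ∣n-1+n∣≡1 : ∀ n → ∣ n - suc n ∣ ≡ 1
  ∣n-1+n∣≡1 zero    = refl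
  ∣n-1+n∣≡1 (suc n) = ∣n-1+n∣≡1 n

  ∣1+n-n∣≡1 : ∀ n → ∣ suc n - n ∣ ≡ 1
  ∣1+n-n∣≡1 n = trans (∣-∣-comm (suc n) n) (∣n-1+n∣≡1 n)

  ∣m-n∣≡1⇒ : ∀ {m n} → ∣ m - n ∣ ≡ 1 → n ≡ suc m ⊎ m ≡ suc n
  ∣m-n∣≡1⇒ {zero}     {suc zero} _ = inj₁ refl
  ∣m-n∣≡1⇒ {suc zero} {zero}     _ = inj₂ refl
  ∣m-n∣≡1⇒ {suc m}    {suc n}    e with ∣m-n∣≡1⇒ {m} {n} e
  ... | inj₁ n≡1+m = inj₁ (cong suc n≡1+m)
  ... | inj₂ m≡1+n = inj₂ (cong suc m≡1+n)

  ∣m-n∣≡1⇒1+2[m⊓n]≡m+n : ∀ {m n} → ∣ m - n ∣ ≡ 1 → suc (2 * (m ⊓ n)) ≡ m + n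
  ∣m-n∣≡1⇒1+2[m⊓n]≡m+n {zero}     {suc zero} _ = refl
  ∣m-n∣≡1⇒1+2[m⊓n]≡m+n {suc zero} {zero}     _ = refl
  ∣m-n∣≡1⇒1+2[m⊓n]≡m+n {suc m}    {suc n}    e = begin
    suc (2 * suc (m ⊓ n))         ≡⟨ cong suc (*-suc 2 (m ⊓ n)) ⟩
    suc (suc (suc (2 * (m ⊓ n)))) ≡⟨ cong (suc ∘ suc) (∣m-n∣≡1⇒1+2[m⊓n]≡m+n {m} {n} e) ⟩
    suc (suc (m + n))             ≡⟨ cong suc (+-suc m n) ⟨
    suc m + suc n                 ∎
    where open ≡-Reasoning

  ∣m-n∣≡1⇒∣∣m-k∣-∣n-k∣∣≡1 : ∀ {m n} → ∣ m - n ∣ ≡ 1 → ∀ k → ∣ ∣ m - k ∣ - ∣ n - k ∣ ∣ ≡ 1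
  ∣m-n∣≡1⇒∣∣m-k∣-∣n-k∣∣≡1 {m}        {n}        e zero
    rewrite ∣-∣-identityʳ m | ∣-∣-identityʳ n = e
  ∣m-n∣≡1⇒∣∣m-k∣-∣n-k∣∣≡1 {zero}     {suc zero} e (suc k) = ∣1+n-n∣≡1 k
  ∣m-n∣≡1⇒∣∣m-k∣-∣n-k∣∣≡1 {suc zero} {zero}     e (suc k) = ∣n-1+n∣≡1 k
  ∣m-n∣≡1⇒∣∣m-k∣-∣n-k∣∣≡1 {suc m}    {suc n}    e (suc k) = ∣m-n∣≡1⇒∣∣m-k∣-∣n-k∣∣≡1 {m} {n} e k

  ∣m+o-n+o∣≡∣m-n∣ : ∀ m n o → ∣ m + o - n + o ∣ ≡ ∣ m - n ∣
  ∣m+o-n+o∣≡∣m-n∣ m n o rewrite +-comm m o | +-comm n o = ∣m+n-m+o∣≡∣n-o∣ o m n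

  m≤n⇒∣m-1+n∣≡1+∣m-n∣ : ∀ {m n} → m ≤ n → ∣ m - suc n ∣ ≡ suc ∣ m - n ∣
  m≤n⇒∣m-1+n∣≡1+∣m-n∣ {zero}  z≤n       = refl
  m≤n⇒∣m-1+n∣≡1+∣m-n∣ {suc m} (s≤s m≤n) = m≤n⇒∣m-1+n∣≡1+∣m-n∣ m≤n

  m<n⇒∣m-n∣≡1+∣1+m-n∣ : ∀ {m n} → m < n → ∣ m - n ∣ ≡ suc ∣ suc m - n ∣
  m<n⇒∣m-n∣≡1+∣1+m-n∣ {zero}  {suc n} _         = refl
  m<n⇒∣m-n∣≡1+∣1+m-n∣ {suc m} {suc n} (s≤s m<n) = m<n⇒∣m-n∣≡1+∣1+m-n∣ m<n

  m<s∧n<t⇒m+n<s*t : ∀ {m n s t} → m < s → n < t → m + n < s * t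
  m<s∧n<t⇒m+n<s*t {m} {n} {suc s} {suc t} (s≤s m≤s) (s≤s n≤t) = s≤s (begin
    m + n           ≤⟨ +-mono-≤ m≤s n≤t ⟩
    s + t           ≡⟨ +-comm s t ⟩
    t + s           ≤⟨ +-monoʳ-≤ t (m≤m*n s (suc t)) ⟩
    t + s * suc t   ∎)
    where open ≤-Reasoning

  m+m≡2*m : ∀ m → m + m ≡ 2 * m
  m+m≡2*m m = cong (m +_) (sym (+-identityʳ m))

  n≡1+m⇒m+n≡1+2*m : ∀ {m n} → n ≡ suc m → m + n ≡ suc (2 * m)
  n≡1+m⇒m+n≡1+2*m {m} refl = trans (+-suc m m) (cong suc (m+m≡2*m m))

  m+n≡o+p∧m+p≡o+n⇒m≡o : ∀ m o {n p} → m + n ≡ o + p → m + p ≡ o + n → m ≡ o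
  m+n≡o+p∧m+p≡o+n⇒m≡o zero    zero    _ _ = refl
  m+n≡o+p∧m+p≡o+n⇒m≡o (suc m) (suc o) eq₁ eq₂ =
    cong suc (m+n≡o+p∧m+p≡o+n⇒m≡o m o (suc-injective eq₁) (suc-injective eq₂))
  m+n≡o+p∧m+p≡o+n⇒m≡o zero    (suc o) {n} {p} eq₁ eq₂ =
    contradiction (subst (p <_) (sym eq₁) (s≤s (m≤n+m p o))) (<-asym (subst (n <_) (sym eq₂) (s≤s (m≤n+m n o))))
  m+n≡o+p∧m+p≡o+n⇒m≡o (suc m) zero    {n} {p} eq₁ eq₂ =
    contradiction (subst (n <_) eq₁ (s≤s (m≤n+m n m))) (<-asym (subst (p <_) eq₂ (s≤s (m≤n+m p m))))

  sum∧offset⇒≡ : ∀ {x y x′ y′ e k} → x + y ≡ x′ + y′ → e + x ≡ k + y → e + x′ ≡ k + y′ → x ≡ x′ × y ≡ y′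
  sum∧offset⇒≡ {x} {y} {x′} {y′} {e} {k} sum≡ offset offset′ =
    x≡x′ , +-cancelˡ-≡ x y y′ (trans sum≡ (cong (_+ y′) (sym x≡x′)))
    where
    cross : x + y′ ≡ x′ + y
    cross = +-cancelˡ-≡ e _ _ (begin
      e + (x + y′)   ≡⟨ +-assoc e x y′ ⟨
      e + x + y′     ≡⟨ cong (_+ y′) offset ⟩
      k + y + y′     ≡⟨ xy∙z≈xz∙y k y y′ ⟩
      k + y′ + y     ≡⟨ cong (_+ y) offset′ ⟨
      e + x′ + y     ≡⟨ +-assoc e x′ y ⟩
      e + (x′ + y)   ∎)
      where open ≡-Reasoning
    x≡x′ : x ≡ x′
    x≡x′ = m+n≡o+p∧m+p≡o+n⇒m≡o x x′ sum≡ cross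

module Paths where
  open Graphs using (T-does)
  open Arithmetic using (absDiff≡∣-∣; ∣n-1+n∣≡1; ∣1+n-n∣≡1; m≤n⇒∣m-1+n∣≡1+∣m-n∣; m<n⇒∣m-n∣≡1+∣1+m-n∣)
  open import Data.Bool using (T)
  open import Data.Fin using (Fin; suc; toℕ; inject₁; fromℕ<)
  open import Data.Fin.Properties using (toℕ-inject₁; toℕ-fromℕ<; toℕ<n; <-cmp)
  open import Data.Nat using (_<_; ∣_-_∣; s≤s; _≟_)
  open import Data.Nat.Properties using (≤-<-trans; ∣-∣-comm)
  open import Data.Product using (_×_; _,_; ∃)
  open import Function.Bundles using (_⇔_)
  open import Relation.Binary.Definitions using (tri<; tri≈; tri>)
  open import Relation.Binary.PropositionalEquality using (_≡_; _≢_; subst)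
  open import Relation.Nullary using (contradiction)

  Path-adj : ∀ {n} {i j : Fin n} → T (adj (Path n) i j) ⇔ ∣ toℕ i - toℕ j ∣ ≡ 1
  Path-adj {n} {i} {j} = subst (λ d → T (adj (Path n) i j) ⇔ d ≡ 1)
    (absDiff≡∣-∣ (toℕ i) (toℕ j)) (T-does (absDiff (toℕ i) (toℕ j) ≟ 1))

  StepToward : ∀ {n} → Fin n → Fin n → Fin n → Set
  StepToward i j k = ∣ toℕ i - toℕ j ∣ ≡ suc ∣ toℕ i - toℕ k ∣ × ∣ toℕ k - toℕ j ∣ ≡ 1

  stepDown : ∀ {n} (i j : Fin n) → toℕ i < toℕ j → ∃ (StepToward i j)
  stepDown i (suc j) (s≤s i≤j) = inject₁ j , closer , adjacent
    where
    closer : ∣ toℕ i - suc (toℕ j) ∣ ≡ suc ∣ toℕ i - toℕ (inject₁ j) ∣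
    closer rewrite toℕ-inject₁ j = m≤n⇒∣m-1+n∣≡1+∣m-n∣ i≤j
    adjacent : ∣ toℕ (inject₁ j) - suc (toℕ j) ∣ ≡ 1
    adjacent rewrite toℕ-inject₁ j = ∣n-1+n∣≡1 (toℕ j)

  stepUp : ∀ {n} (i j : Fin n) → toℕ j < toℕ i → ∃ (StepToward i j)
  stepUp {n} i j j<i = k , closer , adjacent
    where
    1+j<n : suc (toℕ j) < n
    1+j<n = ≤-<-trans j<i (toℕ<n i)
    k : Fin n
    k = fromℕ< 1+j<n
    closer : ∣ toℕ i - toℕ j ∣ ≡ suc ∣ toℕ i - toℕ k ∣
    closer rewrite toℕ-fromℕ< 1+j<n | ∣-∣-comm (toℕ i) (toℕ j) | ∣-∣-comm (toℕ i) (suc (toℕ j)) =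
      m<n⇒∣m-n∣≡1+∣1+m-n∣ j<i
    adjacent : ∣ toℕ k - toℕ j ∣ ≡ 1
    adjacent rewrite toℕ-fromℕ< 1+j<n = ∣1+n-n∣≡1 (toℕ j)

  stepToward : ∀ {n} (i j : Fin n) → i ≢ j → ∃ (StepToward i j)
  stepToward i j i≢j with <-cmp i j
  ... | tri< i<j _ _ = stepDown i j i<j
  ... | tri≈ _ i≡j _ = contradiction i≡j i≢j
  ... | tri> _ _ j<i = stepUp i j j<i

module Grid (s t : ℕ) where
  open Graphs using (dist-least; length-cartesianProduct; eqB⇔≡; □-adj)
  open Arithmetic
    using (m<s∧n<t⇒m+n<s*t; ∣m-n∣≡1⇒∣∣m-k∣-∣n-k∣∣≡1; ∣m+o-n+o∣≡∣m-n∣; ∣m-n∣≡1⇒1+2[m⊓n]≡m+n)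
  open Paths using (Path-adj; stepToward)
  open import Data.Bool using (T)
  open import Data.Bool.Properties using (T-∨; T-∧; T-≡)
  open import Data.Fin using (Fin; toℕ)
  open import Data.Fin.Properties using (toℕ<n; toℕ-injective; _≟_)
  open import Data.List using (length; allFin)
  open import Data.List.Properties using (length-tabulate)
  open import Data.List.Membership.Propositional using (_∈_; lose)
  open import Data.List.Membership.Propositional.Properties using (∈-cartesianProduct⁺; ∈-allFin)
  open import Data.List.Relation.Unary.Any using (satisfied)
  open import Data.List.Relation.Unary.Any.Properties using (any⁺; any⁻)
  open import Data.List.Relation.Unary.Unique.Propositional using (Unique)
  import Data.List.Relation.Unary.Unique.Propositional.Properties as Unique
  open import Data.Nat using (zero; _+_; _*_; _≤_; _<_; _≤?_; ∣_-_∣)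
  open import Data.Nat.Properties hiding (_≟_)
  open import Data.Product using (_×_; _,_; ∃)
  open import Data.Product.Function.NonDependent.Propositional using (_×-⇔_)
  open import Data.Sum using (_⊎_; inj₁; inj₂)
  open import Data.Sum.Function.Propositional using (_⊎-⇔_)
  open import Function using (_∘_)
  open import Function.Bundles using (_⇔_; Equivalence; mk⇔)
  open import Function.Construct.Composition using (_⇔-∘_)
  open import Function.Construct.Identity using (⇔-id)
  open import Relation.Binary.PropositionalEquality
  open import Relation.Nullary using (yes; no; contradiction)
  open import Algebra.Properties.CommutativeSemigroup +-commutativeSemigroup using (interchange)
  open Equivalence using (to; from)

  G : Graph
  G = Path s □ Path t

  Vertex : Set
  Vertex = Fin s × Fin t

  manhattan : Vertex → Vertex → ℕ
  manhattan (a , b) (c , d) = ∣ toℕ a - toℕ c ∣ + ∣ toℕ b - toℕ d ∣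

  manhattan-refl : ∀ x → manhattan x x ≡ 0
  manhattan-refl (a , b) = cong₂ _+_ (∣n-n∣≡0 (toℕ a)) (∣n-n∣≡0 (toℕ b))

  manhattan≡0⇒≡ : ∀ x y → manhattan x y ≡ 0 → x ≡ y
  manhattan≡0⇒≡ (a , b) (c , d) m≡0 = cong₂ _,_
    (toℕ-injective (∣m-n∣≡0⇒m≡n (m+n≡0⇒m≡0 _ m≡0))) (toℕ-injective (∣m-n∣≡0⇒m≡n (m+n≡0⇒n≡0 _ m≡0)))

  manhattan-triangle : ∀ x y z → manhattan x z ≤ manhattan x y + manhattan y z
  manhattan-triangle (a , b) (c , d) (e , f) = ≤-trans
    (+-mono-≤ (∣-∣-triangle (toℕ a) (toℕ c) (toℕ e)) (∣-∣-triangle (toℕ b) (toℕ d) (toℕ f)))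
    (≤-reflexive (interchange ∣ toℕ a - toℕ c ∣ ∣ toℕ c - toℕ e ∣ ∣ toℕ b - toℕ d ∣ ∣ toℕ d - toℕ f ∣))

  manhattan<|V| : ∀ x y → manhattan x y < length (verts G)
  manhattan<|V| (a , b) (c , d) = subst (manhattan (a , b) (c , d) <_) (sym |V|≡s*t)
    (m<s∧n<t⇒m+n<s*t (∣toℕ-toℕ∣< a c) (∣toℕ-toℕ∣< b d))
    where
    ∣toℕ-toℕ∣< : ∀ {n} (i j : Fin n) → ∣ toℕ i - toℕ j ∣ < n
    ∣toℕ-toℕ∣< i j = ≤-<-trans (∣m-n∣≤m⊔n (toℕ i) (toℕ j)) (⊔-lub (toℕ<n i) (toℕ<n j))
    |V|≡s*t : length (verts G) ≡ s * t
    |V|≡s*t = trans (length-cartesianProduct (allFin s) (allFin t))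
                    (cong₂ _*_ (length-tabulate {n = s} _) (length-tabulate {n = t} _))

  verts∈ : ∀ x → x ∈ verts G
  verts∈ (a , b) = ∈-cartesianProduct⁺ (∈-allFin a) (∈-allFin b)

  verts-unique : Unique (verts G)
  verts-unique = Unique.cartesianProduct⁺ (Unique.allFin⁺ s) (Unique.allFin⁺ t)

  Neighbours : Vertex → Vertex → Set
  Neighbours (a , b) (c , d) = (a ≡ c × ∣ toℕ b - toℕ d ∣ ≡ 1) ⊎ (∣ toℕ a - toℕ c ∣ ≡ 1 × b ≡ d)

  adj⇔Neighbours : ∀ {x y} → T (adj G x y) ⇔ Neighbours x y
  adj⇔Neighbours {a , b} {c , d} =
    (⇔-id _ ×-⇔ Path-adj {i = b} {d} ⊎-⇔ Path-adj {i = a} {c} ×-⇔ ⇔-id _) ⇔-∘ □-adj {Path s} {Path t}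

  IsEdge⇒Neighbours : ∀ {x y} → IsEdge G (x , y) → Neighbours x y
  IsEdge⇒Neighbours = to adj⇔Neighbours ∘ from T-≡

  Neighbours⇒manhattan≡1 : ∀ {x y} → Neighbours x y → manhattan x y ≡ 1
  Neighbours⇒manhattan≡1 {a , _} (inj₁ (refl , b~d)) = cong₂ _+_ (∣n-n∣≡0 (toℕ a)) b~d
  Neighbours⇒manhattan≡1 {_ , b} (inj₂ (a~c , refl)) = cong₂ _+_ a~c (∣n-n∣≡0 (toℕ b))

  closerNeighbour : ∀ x y {k} → manhattan x y ≡ suc k → ∃ λ w → manhattan x w ≡ k × Neighbours w y
  closerNeighbour (a , b) (c , d) m≡1+k with a ≟ c | b ≟ d
  ... | no a≢c | _ with stepToward a c a≢c
  ...   | c′ , closer , c′~c =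
    (c′ , d) , suc-injective (trans (cong (_+ ∣ toℕ b - toℕ d ∣) (sym closer)) m≡1+k) , inj₂ (c′~c , refl)
  closerNeighbour (a , b) (.a , d) m≡1+k | yes refl | no b≢d with stepToward b d b≢d
  ...   | d′ , closer , d′~d =
    (a , d′) , suc-injective (trans (sym (+-suc _ _)) (trans (cong (∣ toℕ a - toℕ a ∣ +_) (sym closer)) m≡1+k)) ,
    inj₁ (refl , d′~d)
  closerNeighbour x .x m≡1+k | yes refl | yes refl = contradiction (trans (sym (manhattan-refl x)) m≡1+k) 0≢1+n

  reach⇒manhattan≤ : ∀ k x y → T (reach G k x y) → manhattan x y ≤ k
  reach⇒manhattan≤ zero x y r with to (eqB⇔≡ G {x} {y}) r
  ... | refl = ≤-reflexive (manhattan-refl x)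
  reach⇒manhattan≤ (suc k) x y r with to T-∨ r
  ... | inj₁ r′ = m≤n⇒m≤1+n (reach⇒manhattan≤ k x y r′)
  ... | inj₂ some with satisfied (any⁻ _ (verts G) some)
  ...   | w , r′∧w~y with to T-∧ r′∧w~y
  ...     | r′ , w~y = begin
    manhattan x y                  ≤⟨ manhattan-triangle x w y ⟩
    manhattan x w + manhattan w y  ≤⟨ +-mono-≤ (reach⇒manhattan≤ k x w r′)
                                               (≤-reflexive (Neighbours⇒manhattan≡1 {w} {y} (to adj⇔Neighbours w~y))) ⟩
    k + 1                          ≡⟨ +-comm k 1 ⟩
    suc k                          ∎
    where open ≤-Reasoning

  manhattan≤⇒reach : ∀ k x y → manhattan x y ≤ k → T (reach G k x y)
  manhattan≤⇒reach zero x y m≤0 with manhattan≡0⇒≡ x y (n≤0⇒n≡0 m≤0)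
  ... | refl = from (eqB⇔≡ G {x} {x}) refl
  manhattan≤⇒reach (suc k) x y m≤1+k with manhattan x y ≤? k
  ... | yes m≤k = from T-∨ (inj₁ (manhattan≤⇒reach k x y m≤k))
  ... | no m≰k with closerNeighbour x y (≤-antisym m≤1+k (≰⇒> m≰k))
  ...   | w , m≡k , w~y = from T-∨ (inj₂ (any⁺ _ (lose (verts∈ w) (from T-∧
          (manhattan≤⇒reach k x w (≤-reflexive m≡k) , from (adj⇔Neighbours {w} {y}) w~y)))))

  dist≡manhattan : ∀ x y → dist G x y ≡ manhattan x y
  dist≡manhattan x y =
    dist-least G x y (λ j → reach⇒manhattan≤ j x y) (manhattan≤⇒reach _ x y ≤-refl) (manhattan<|V| x y)

  Neighbours⇒∣Δmanhattan∣≡1 : ∀ {x y} → Neighbours x y → ∀ v → ∣ manhattan x v - manhattan y v ∣ ≡ 1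
  Neighbours⇒∣Δmanhattan∣≡1 {a , b} {_ , d} (inj₁ (refl , b~d)) (i , j) =
    trans (∣m+n-m+o∣≡∣n-o∣ ∣ toℕ a - toℕ i ∣ ∣ toℕ b - toℕ j ∣ ∣ toℕ d - toℕ j ∣)
          (∣m-n∣≡1⇒∣∣m-k∣-∣n-k∣∣≡1 {toℕ b} {toℕ d} b~d (toℕ j))
  Neighbours⇒∣Δmanhattan∣≡1 {a , b} {c , _} (inj₂ (a~c , refl)) (i , j) =
    trans (∣m+o-n+o∣≡∣m-n∣ ∣ toℕ a - toℕ i ∣ ∣ toℕ c - toℕ i ∣ ∣ toℕ b - toℕ j ∣)
          (∣m-n∣≡1⇒∣∣m-k∣-∣n-k∣∣≡1 {toℕ a} {toℕ c} a~c (toℕ i))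

  1+2*edgeDist≡manhattan+manhattan : ∀ x y → IsEdge G (x , y) → ∀ v →
    suc (2 * edgeDist G (x , y) v) ≡ manhattan x v + manhattan y v
  1+2*edgeDist≡manhattan+manhattan x y xy v rewrite dist≡manhattan x v | dist≡manhattan y v =
    ∣m-n∣≡1⇒1+2[m⊓n]≡m+n {manhattan x v} {manhattan y v} (Neighbours⇒∣Δmanhattan∣≡1 {x} {y} (IsEdge⇒Neighbours xy) v)

  edgeDist≡⇔manhattan+manhattan≡ : ∀ x y x′ y′ → IsEdge G (x , y) → IsEdge G (x′ , y′) → ∀ v →
    edgeDist G (x , y) v ≡ edgeDist G (x′ , y′) v ⇔ manhattan x v + manhattan y v ≡ manhattan x′ v + manhattan y′ v
  edgeDist≡⇔manhattan+manhattan≡ x y x′ y′ xy x′y′ v = mk⇔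
    (λ d≡d′ → trans (sym (formula x y xy)) (trans (cong (suc ∘ (2 *_)) d≡d′) (formula x′ y′ x′y′)))
    (λ Σ≡Σ′ → *-cancelˡ-≡ _ _ 2 (suc-injective (trans (formula x y xy) (trans Σ≡Σ′ (sym (formula x′ y′ x′y′))))))
    where
    formula : ∀ x y → IsEdge G (x , y) → suc (2 * edgeDist G (x , y) v) ≡ manhattan x v + manhattan y v
    formula x y xy = 1+2*edgeDist≡manhattan+manhattan x y xy v

module CornerSquare (s t : ℕ) where
  open Grid (suc (suc s)) (suc (suc t))
  open EdgeResolving G using (disjointResolvingSets⇒2≤weight)
  open import Data.Fin using (zero; suc; toℕ)
  open import Data.Nat using (_+_)
  open import Data.Nat.Properties using (+-identityʳ; +-comm; +-suc)
  open import Data.Product using (_,_)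
  open import Data.Rational using (1ℚ) renaming (_+_ to _+ℚ_; _≤_ to _≤ℚ_)
  open import Data.Sum using (_⊎_; inj₁; inj₂)
  open import Function.Bundles using (Equivalence)
  open import Relation.Binary.PropositionalEquality using (_≡_; refl; cong; trans)
  open Equivalence using (from)

  A B C D : Vertex
  A = zero , zero
  B = suc zero , zero
  C = zero , suc zero
  D = suc zero , suc zero

  square-split : ∀ v → manhattan B v ≡ manhattan C v ⊎ manhattan A v ≡ manhattan D v
  square-split (zero  , zero)  = inj₁ refl
  square-split (zero  , suc j) = inj₂ refl
  square-split (suc i , zero)  = inj₂ (trans (+-identityʳ (suc (toℕ i))) (+-comm 1 (toℕ i)))
  square-split (suc i , suc j) = inj₁ (+-suc (toℕ i) (toℕ j))

  edgeDist-split : ∀ v → edgeDist G (A , B) v ≡ edgeDist G (A , C) v ⊎ edgeDist G (A , B) v ≡ edgeDist G (B , D) v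
  edgeDist-split v with square-split v
  ... | inj₁ B≡C = inj₁ (from (edgeDist≡⇔manhattan+manhattan≡ A B A C refl refl v) (cong (manhattan A v +_) B≡C))
  ... | inj₂ A≡D = inj₂ (from (edgeDist≡⇔manhattan+manhattan≡ A B B D refl refl v)
                              (trans (cong (_+ manhattan B v) A≡D) (+-comm (manhattan D v) (manhattan B v))))

  2≤weight : ∀ g → IsEdgeResolving G g → 1ℚ +ℚ 1ℚ ≤ℚ sumℚ g (verts G)
  2≤weight = disjointResolvingSets⇒2≤weight {A , B} {A , C} {B , D} refl refl refl
    (λ { (inj₁ (_ , ())) ; (inj₂ (() , _)) })
    (λ { (inj₁ (() , _)) ; (inj₂ (() , _)) })
    edgeDist-split

module Corners (S T : ℕ) where
  open Grid (suc S) (suc T)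
  open Arithmetic using (∣m-n∣≡1⇒; m+m≡2*m; n≡1+m⇒m+n≡1+2*m; sum∧offset⇒≡)
  open import Data.Empty using (⊥-elim)
  open import Data.Fin using (zero; toℕ; fromℕ)
  open import Data.Fin.Properties using (toℕ-fromℕ; toℕ<n; toℕ-injective)
  open import Data.Nat using (_+_; _*_; _≤_; ∣_-_∣; _≟_)
  open import Data.Nat.Properties
  open import Data.Product using (_×_; _,_; proj₁; proj₂; swap)
  open import Data.Product.Properties using (,-injective)
  open import Data.Sum using (_⊎_; inj₁; inj₂)
  import Data.Sum as Sum
  open import Function.Bundles using (Equivalence)
  open import Relation.Binary.PropositionalEquality
  open import Relation.Nullary using (yes; no)
  open import Algebra.Properties.CommutativeSemigroup +-commutativeSemigroup using (interchange)
  open Equivalence using (to)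

  A L : Vertex
  A = zero , zero
  L = fromℕ S , zero

  manhattan-A : ∀ i j → manhattan (i , j) A ≡ toℕ i + toℕ j
  manhattan-A i j = cong₂ _+_ (∣-∣-identityʳ (toℕ i)) (∣-∣-identityʳ (toℕ j))

  manhattan-L : ∀ i j → manhattan (i , j) L + toℕ i ≡ S + toℕ j
  manhattan-L i j rewrite toℕ-fromℕ S | ∣-∣-identityʳ (toℕ j) = begin
    ∣ toℕ i - S ∣ + toℕ j + toℕ i    ≡⟨ +-assoc ∣ toℕ i - S ∣ (toℕ j) (toℕ i) ⟩
    ∣ toℕ i - S ∣ + (toℕ j + toℕ i)  ≡⟨ cong (∣ toℕ i - S ∣ +_) (+-comm (toℕ j) (toℕ i)) ⟩
    ∣ toℕ i - S ∣ + (toℕ i + toℕ j)  ≡⟨ +-assoc ∣ toℕ i - S ∣ (toℕ i) (toℕ j) ⟨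
    ∣ toℕ i - S ∣ + toℕ i + toℕ j    ≡⟨ cong (_+ toℕ j) ∣i-S∣+i≡S ⟩
    S + toℕ j                        ∎
    where
    open ≡-Reasoning
    i≤S : toℕ i ≤ S
    i≤S = ≤-pred (toℕ<n i)
    ∣i-S∣+i≡S : ∣ toℕ i - S ∣ + toℕ i ≡ S
    ∣i-S∣+i≡S = trans (cong (_+ toℕ i) (m≤n⇒∣m-n∣≡n∸m i≤S)) (m∸n+n≡m i≤S)

  doubledMidpoint : Vertex → Vertex → ℕ × ℕ
  doubledMidpoint (a , b) (c , d) = toℕ a + toℕ c , toℕ b + toℕ d

  doubledMidpoint-comm : ∀ x y → doubledMidpoint x y ≡ doubledMidpoint y x
  doubledMidpoint-comm (a , b) (c , d) = cong₂ _,_ (+-comm (toℕ a) (toℕ c)) (+-comm (toℕ b) (toℕ d))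

  cornerSums⇒doubledMidpoint≡ : ∀ x y x′ y′ →
    manhattan x A + manhattan y A ≡ manhattan x′ A + manhattan y′ A →
    manhattan x L + manhattan y L ≡ manhattan x′ L + manhattan y′ L →
    doubledMidpoint x y ≡ doubledMidpoint x′ y′
  cornerSums⇒doubledMidpoint≡ (a , b) (c , d) (a′ , b′) (c′ , d′) A≡ L≡ =
    let (X≡ , Y≡) = sum∧offset⇒≡ {e = manhattan (a , b) L + manhattan (c , d) L} {k = S + S}
                      (trans (sym (sumA a b c d)) (trans A≡ (sumA a′ b′ c′ d′)))
                      (sumL a b c d)
                      (trans (cong (_+ (toℕ a′ + toℕ c′)) L≡) (sumL a′ b′ c′ d′))
    in cong₂ _,_ X≡ Y≡
    where
    sumA : ∀ a b c d → manhattan (a , b) A + manhattan (c , d) A ≡ (toℕ a + toℕ c) + (toℕ b + toℕ d)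
    sumA a b c d = trans (cong₂ _+_ (manhattan-A a b) (manhattan-A c d)) (interchange (toℕ a) (toℕ b) (toℕ c) (toℕ d))
    sumL : ∀ a b c d → (manhattan (a , b) L + manhattan (c , d) L) + (toℕ a + toℕ c) ≡ (S + S) + (toℕ b + toℕ d)
    sumL a b c d = begin
      (manhattan (a , b) L + manhattan (c , d) L) + (toℕ a + toℕ c)
        ≡⟨ interchange (manhattan (a , b) L) (manhattan (c , d) L) (toℕ a) (toℕ c) ⟩
      (manhattan (a , b) L + toℕ a) + (manhattan (c , d) L + toℕ c)
        ≡⟨ cong₂ _+_ (manhattan-L a b) (manhattan-L c d) ⟩
      (S + toℕ b) + (S + toℕ d)
        ≡⟨ interchange S (toℕ b) S (toℕ d) ⟩
      (S + S) + (toℕ b + toℕ d) ∎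
      where open ≡-Reasoning

  data Step : Vertex → Vertex → Set where
    right : ∀ {a c b} → toℕ c ≡ suc (toℕ a) → Step (a , b) (c , b)
    up    : ∀ {a b d} → toℕ d ≡ suc (toℕ b) → Step (a , b) (a , d)

  Neighbours⇒Step : ∀ x y → Neighbours x y → Step x y ⊎ Step y x
  Neighbours⇒Step (a , b) (.a , d) (inj₁ (refl , b~d)) = Sum.map up up (∣m-n∣≡1⇒ {toℕ b} {toℕ d} b~d)
  Neighbours⇒Step (a , b) (c , .b) (inj₂ (a~c , refl)) = Sum.map right right (∣m-n∣≡1⇒ {toℕ a} {toℕ c} a~c)

  stepMidpoint : ∀ {x y} → Step x y → ℕ × ℕ
  stepMidpoint (right {a} {b = b} _) = suc (2 * toℕ a) , 2 * toℕ b
  stepMidpoint (up {a} {b} _)        = 2 * toℕ a , suc (2 * toℕ b)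

  doubledMidpoint≡stepMidpoint : ∀ {x y} (step : Step x y) → doubledMidpoint x y ≡ stepMidpoint step
  doubledMidpoint≡stepMidpoint (right {b = b} c≡1+a) = cong₂ _,_ (n≡1+m⇒m+n≡1+2*m c≡1+a) (m+m≡2*m (toℕ b))
  doubledMidpoint≡stepMidpoint (up {a} d≡1+b)        = cong₂ _,_ (m+m≡2*m (toℕ a)) (n≡1+m⇒m+n≡1+2*m d≡1+b)

  stepMidpoint-injective : ∀ {x y x′ y′} (step : Step x y) (step′ : Step x′ y′) →
    stepMidpoint step ≡ stepMidpoint step′ → x ≡ x′ × y ≡ y′
  stepMidpoint-injective (right c≡1+a) (right c′≡1+a′) eq with ,-injective eq
  ... | 2a+1≡ , 2b≡ = cong₂ _,_ (toℕ-injective a≡a′) (toℕ-injective b≡b′) ,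
                      cong₂ _,_ (toℕ-injective (trans c≡1+a (trans (cong suc a≡a′) (sym c′≡1+a′)))) (toℕ-injective b≡b′)
    where
    a≡a′ = *-cancelˡ-≡ _ _ 2 (suc-injective 2a+1≡)
    b≡b′ = *-cancelˡ-≡ _ _ 2 2b≡
  stepMidpoint-injective (up d≡1+b) (up d′≡1+b′) eq with ,-injective eq
  ... | 2a≡ , 2b+1≡ = cong₂ _,_ (toℕ-injective a≡a′) (toℕ-injective b≡b′) ,
                      cong₂ _,_ (toℕ-injective a≡a′) (toℕ-injective (trans d≡1+b (trans (cong suc b≡b′) (sym d′≡1+b′))))
    where
    a≡a′ = *-cancelˡ-≡ _ _ 2 2a≡
    b≡b′ = *-cancelˡ-≡ _ _ 2 (suc-injective 2b+1≡)
  stepMidpoint-injective (right {b = b} _) (up {b = b′} _) eq = ⊥-elim (even≢odd (toℕ b) (toℕ b′) (proj₂ (,-injective eq)))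
  stepMidpoint-injective (up {a} _) (right {a′} _)         eq = ⊥-elim (even≢odd (toℕ a) (toℕ a′) (proj₁ (,-injective eq)))

  Step-doubledMidpoint-injective : ∀ {x y x′ y′} (step : Step x y) (step′ : Step x′ y′) →
    doubledMidpoint x y ≡ doubledMidpoint x′ y′ → x ≡ x′ × y ≡ y′
  Step-doubledMidpoint-injective step step′ eq = stepMidpoint-injective step step′
    (trans (sym (doubledMidpoint≡stepMidpoint step)) (trans eq (doubledMidpoint≡stepMidpoint step′)))

  doubledMidpoint-determines-edge : ∀ x y x′ y′ → IsEdge G (x , y) → IsEdge G (x′ , y′) →
    doubledMidpoint x y ≡ doubledMidpoint x′ y′ → (x ≡ x′ × y ≡ y′) ⊎ (x ≡ y′ × y ≡ x′)
  doubledMidpoint-determines-edge x y x′ y′ xy x′y′ eq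
    with Neighbours⇒Step x y (IsEdge⇒Neighbours xy) | Neighbours⇒Step x′ y′ (IsEdge⇒Neighbours x′y′)
  ... | inj₁ step | inj₁ step′ = inj₁ (Step-doubledMidpoint-injective step step′ eq)
  ... | inj₁ step | inj₂ step′ =
    inj₂ (Step-doubledMidpoint-injective step step′ (trans eq (doubledMidpoint-comm x′ y′)))
  ... | inj₂ step | inj₁ step′ =
    inj₂ (swap (Step-doubledMidpoint-injective step step′ (trans (doubledMidpoint-comm y x) eq)))
  ... | inj₂ step | inj₂ step′ =
    inj₁ (swap (Step-doubledMidpoint-injective step step′
                 (trans (doubledMidpoint-comm y x) (trans eq (doubledMidpoint-comm x′ y′)))))

  cornersResolve : ∀ e₁ e₂ → IsEdge G e₁ → IsEdge G e₂ → DistinctEdges G e₁ e₂ →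
    edgeDist G e₁ A ≢ edgeDist G e₂ A ⊎ edgeDist G e₁ L ≢ edgeDist G e₂ L
  cornersResolve (x , y) (x′ , y′) xy x′y′ distinct
    with edgeDist G (x , y) A ≟ edgeDist G (x′ , y′) A | edgeDist G (x , y) L ≟ edgeDist G (x′ , y′) L
  ... | no ≢A  | _      = inj₁ ≢A
  ... | yes _  | no ≢L  = inj₂ ≢L
  ... | yes ≡A | yes ≡L = ⊥-elim (distinct (doubledMidpoint-determines-edge x y x′ y′ xy x′y′
    (cornerSums⇒doubledMidpoint≡ x y x′ y′ (to (edgeDist≡⇔manhattan+manhattan≡ x y x′ y′ xy x′y′ A) ≡A)
                                           (to (edgeDist≡⇔manhattan+manhattan≡ x y x′ y′ xy x′y′ L) ≡L))))

open import Data.Nat using (s≤s; z≤n)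
open import Data.Product using (_,_)
open import Data.Rational using (1ℚ; _+_)

mainTheorem15 : (s t : ℕ) → s ≥ 2 → t ≥ 2 →
    EdimF≡ (Path s □ Path t) (1ℚ + 1ℚ)
mainTheorem15 (suc (suc s)) (suc (suc t)) (s≤s (s≤s z≤n)) (s≤s (s≤s z≤n)) =
  resolvingPair⇒weight2 (λ ()) verts-unique (verts∈ A) (verts∈ L) cornersResolve ,
  CornerSquare.2≤weight s t
  where
  open Grid (suc (suc s)) (suc (suc t))
  open Corners (suc s) (suc t)
  open EdgeResolving G using (resolvingPair⇒weight2)
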